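{- Let $G$ be a graph such that the set $X$ of vertices of degree $2$ in $G$ is nonempty. Let $G'$ be the graph obtained from $G$ by smoothing a vertex of $X$. Then $\kappa_3(G')\geq \kappa_3(G)$.
   Context: For a vertex $u$ of degree $2$ with neighbors $w_1,w_2$, to smooth $u$ means to delete $u$ and then add an edge between $w_1$ and $w_2$. For a graph $G$ and a set $S$ of $3$ vertices of $G$, $\kappa(S)$ denotes the maximum number $\ell$ of edge-disjoint trees $T_1,\dots,T_\ell$ in $G$, each containing all vertices of $S$, such that $V(T_i)\cap V(T_j)=S$ for every pair of distinct $i,j$. The generalized $3$-connectivity is $\kappa_3(G)=\min\{\kappa(S)\}$, the minimum taken over all $3$-subsets $S$ of $V(G)$. -}

module Defs where

open import Data.Nat using (ℕ; zero; suc; _+_)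
open import Data.Fin using (Fin; punchOut; _≟_)
open import Data.Product using (_×_; _,_; proj₁; proj₂; Σ; ∃; ∃-syntax)
open import Data.Sum using (_⊎_)
open import Data.List using (List; []; _∷_; _++_; length; lookup)
open import Data.List.Membership.Propositional using (_∈_)
open import Data.List.Relation.Unary.Unique.Propositional using (Unique)
import Data.Empty
open import Data.Bool using (if_then_else_)
open import Relation.Nullary using (¬_; yes; no; does)
open import Relation.Binary.PropositionalEquality using (_≡_; _≢_)

-- Finite multigraphs on vertex set Fin n.  Edges are listed (parallel
-- edges and loops are representable); an edge is identified by its
-- position in the list.

record Graph (n : ℕ) : Set where
  constructor mkGraph
  field
    edges : List (Fin n × Fin n)

open Graph public

module _ {n : ℕ} (G : Graph n) where

  Edge : Set
  Edge = Fin (length (edges G))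

  ends : Edge → Fin n × Fin n
  ends e = lookup (edges G) e

  Joins : Edge → Fin n → Fin n → Set
  Joins e x y = (ends e ≡ (x , y)) ⊎ (ends e ≡ (y , x))

  Adj : Fin n → Fin n → Set
  Adj x y = ∃[ e ] Joins e x y

  Simple : Set
  Simple = (∀ e → proj₁ (ends e) ≢ proj₂ (ends e))
         × (∀ e f → Joins f (proj₁ (ends e)) (proj₂ (ends e)) → e ≡ f)

  IncidentTo : Fin n → Edge → Set
  IncidentTo x e = (proj₁ (ends e) ≡ x) ⊎ (proj₂ (ends e) ≡ x)

  -- Subgraph spanned by a list of edges ("edge set" es).
  -- A walk from x to y using the listed edges, recording the edges used.
  data Walk (es : List Edge) : Fin n → Fin n → List Edge → Set where
    []  : ∀ {x} → Walk es x x []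
    _∷_ : ∀ {x y z e ws} → (e ∈ es) × Joins e x y → Walk es y z ws
        → Walk es x z (e ∷ ws)

  _∈V_ : Fin n → List Edge → Set
  x ∈V es = ∃[ e ] (e ∈ es × IncidentTo x e)

  Connected : List Edge → Set
  Connected es = ∀ x y → x ∈V es → y ∈V es → ∃[ ws ] Walk es x y ws

  Acyclic : List Edge → Set
  Acyclic es = ∀ x e ws → Unique (e ∷ ws) → ¬ Walk es x x (e ∷ ws)

  IsTree : List Edge → Set
  IsTree es = Unique es × Connected es × Acyclic es

  Distinct3 : Fin n → Fin n → Fin n → Set
  Distinct3 a b c = a ≢ b × a ≢ c × b ≢ c

  -- there are ℓ trees T_1..T_ℓ each containing S = {a,b,c}, pairwise
  -- edge-disjoint with V(T_i) ∩ V(T_j) = S.   This is  κ(S) ≥ ℓ.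
  InternallyDisjointSTrees : Fin n → Fin n → Fin n → ℕ → Set
  InternallyDisjointSTrees a b c ℓ =
    Σ (Fin ℓ → List Edge) λ T →
        (∀ i → IsTree (T i) × a ∈V T i × b ∈V T i × c ∈V T i)
      × (∀ i j → i ≢ j →
           (∀ e → e ∈ T i → e ∈ T j → Data.Empty.⊥)
         × (∀ x → x ∈V T i → x ∈V T j → (x ≡ a) ⊎ (x ≡ b) ⊎ (x ≡ c)))

  κ₃≥ : ℕ → Set
  κ₃≥ ℓ = ∀ a b c → Distinct3 a b c → InternallyDisjointSTrees a b c ℓ

  -- degree (a loop contributes 2)
  degree : Fin n → ℕ
  degree x = go (edges G)
    where
    go : List (Fin n × Fin n) → ℕ
    go [] = 0
    go ((a , b) ∷ r) =
      (if does (a ≟ x) then 1 else 0) + (if does (b ≟ x) then 1 else 0) + go r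

-- Smoothing a vertex u (with neighbours w₁ ≠ u, w₂ ≠ u): delete u
-- (vertices ≠ u are renumbered by punchOut), delete all edges at u,
-- and add a (possibly parallel) edge w₁w₂.

smoothEdges : {n : ℕ} → Fin (suc n) → List (Fin (suc n) × Fin (suc n))
            → List (Fin n × Fin n)
smoothEdges u [] = []
smoothEdges u ((a , b) ∷ r) with u ≟ a | u ≟ b
... | no p | no q = (punchOut p , punchOut q) ∷ smoothEdges u r
... | _    | _    = smoothEdges u r

smooth : {n : ℕ} (G : Graph (suc n)) (u w₁ w₂ : Fin (suc n))
       → u ≢ w₁ → u ≢ w₂ → Graph n
smooth G u w₁ w₂ p₁ p₂ =
  mkGraph (smoothEdges u (edges G) ++ ((punchOut p₁ , punchOut p₂) ∷ []))

-- Smoothing u sends an edge set T of G to the edge set T' of G' made of the edges of T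
-- avoiding u, plus the new edge w₁w₂ when T contains both edges at u. As u has degree 2, a
-- walk of T through u enters and leaves it along these two edges, so walks of T between
-- vertices other than u become walks of T': trees containing S become connected and contain
-- S. Conversely a walk of T' expands to a walk of T without repeated edges, so a cycle of T'
-- would give one of T. Since V(T') ⊆ V(T) and E(T') comes from E(T), internally disjoint
-- S-trees of G give internally disjoint S-trees of G'.
module Submission where

open import Defs
open import Data.Nat using (ℕ; suc; _+_; _≤_; z≤n; s≤s)
open import Data.Nat.Properties using (≤-trans; m≤n+m; +-mono-≤)
open import Data.Fin using (Fin; zero; suc; punchOut; punchIn; _≟_)
open import Data.Fin.Properties using (punchIn-punchOut; punchIn-injective; punchInᵢ≢i; suc-injective)
open import Data.Product using (_×_; _,_; proj₁; proj₂; ∃-syntax)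
open import Data.Sum as Sum using (_⊎_; inj₁; inj₂)
open import Data.List using (List; []; _∷_; _++_; length; lookup; filter; allFin)
open import Data.List.Membership.Propositional using (_∈_; _∉_)
open import Data.List.Membership.Propositional.Properties using (∈-filter⁺; ∈-filter⁻; ∈-allFin)
open import Data.List.Relation.Unary.Any using (here; there; any?)
open import Data.List.Relation.Unary.All as All using (All; []; _∷_)
open import Data.List.Relation.Unary.All.Properties.Core using (All¬⇒¬Any; ¬Any⇒All¬)
open import Data.List.Relation.Unary.AllPairs using ([]; _∷_)
open import Data.List.Relation.Unary.Unique.Propositional using (Unique)
open import Data.List.Relation.Unary.Unique.Propositional.Properties using (filter⁺; allFin⁺)
open import Data.Maybe using (Maybe; just; nothing; map)
open import Data.Maybe.Properties using (map-injective; map-just; map-nothing)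
open import Data.Empty using (⊥; ⊥-elim)
open import Relation.Nullary using (¬_; yes; no; does; Dec)
open import Relation.Nullary.Decidable using (dec-true; _×-dec_)
open import Data.Bool using (if_then_else_)
open import Relation.Binary.PropositionalEquality
open import Function using (_∘_; _∋_)

module _ {n : ℕ} (H : Graph n) where

  Joins-sym : ∀ {e x y} → Joins H e x y → Joins H e y x
  Joins-sym (inj₁ q) = inj₂ q
  Joins-sym (inj₂ q) = inj₁ q

  Joins⇒IncidentTo : ∀ {e x y} → Joins H e x y → IncidentTo H x e
  Joins⇒IncidentTo (inj₁ q) = inj₁ (cong proj₁ q)
  Joins⇒IncidentTo (inj₂ q) = inj₂ (cong proj₂ q)

  Joins-functional : ∀ {e x y z} → Joins H e x y → Joins H e x z → y ≡ z
  Joins-functional (inj₁ p) (inj₁ q) = cong proj₂ (trans (sym p) q)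
  Joins-functional (inj₁ p) (inj₂ q) = trans (cong proj₂ (trans (sym p) q)) (cong proj₁ (trans (sym p) q))
  Joins-functional (inj₂ p) (inj₁ q) = trans (cong proj₁ (trans (sym p) q)) (cong proj₂ (trans (sym p) q))
  Joins-functional (inj₂ p) (inj₂ q) = cong proj₁ (trans (sym p) q)

  Walk⇒∈V : ∀ {es x y ws} → Walk H es x y ws → x ≢ y → _∈V_ H x es
  Walk⇒∈V []                     x≢y = ⊥-elim (x≢y refl)
  Walk⇒∈V (_∷_ {e = e} (e∈ , J) _) _ = e , e∈ , Joins⇒IncidentTo J

tailIndices : ∀ {m} → List (Fin (suc m)) → List (Fin m)
tailIndices []           = []
tailIndices (zero  ∷ is) = tailIndices is
tailIndices (suc i ∷ is) = i ∷ tailIndices is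

module _ {m : ℕ} where

  tailIndices-All : ∀ {P : Fin (suc m) → Set} {is} → All P is → All (λ i → P (suc i)) (tailIndices is)
  tailIndices-All {is = []}        []       = []
  tailIndices-All {is = zero  ∷ _} (_ ∷ ps) = tailIndices-All ps
  tailIndices-All {is = suc _ ∷ _} (p ∷ ps) = p ∷ tailIndices-All ps

  tailIndices-Unique : ∀ {is : List (Fin (suc m))} → Unique is → Unique (tailIndices is)
  tailIndices-Unique {[]}        []       = []
  tailIndices-Unique {zero  ∷ _} (_ ∷ us) = tailIndices-Unique us
  tailIndices-Unique {suc _ ∷ _} (i≢ ∷ us) =
    All.map (λ i≢j i≡j → i≢j (cong suc i≡j)) (tailIndices-All i≢) ∷ tailIndices-Unique us

  length-tailIndices-∉ : ∀ {is : List (Fin (suc m))} → zero ∉ is → length is ≤ length (tailIndices is)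
  length-tailIndices-∉ {[]}         _  = z≤n
  length-tailIndices-∉ {zero  ∷ is} 0∉ = ⊥-elim (0∉ (here refl))
  length-tailIndices-∉ {suc _ ∷ is} 0∉ = s≤s (length-tailIndices-∉ (λ 0∈ → 0∉ (there 0∈)))

  length-tailIndices : ∀ {is : List (Fin (suc m))} → Unique is → length is ≤ suc (length (tailIndices is))
  length-tailIndices {[]}         _        = z≤n
  length-tailIndices {zero  ∷ is} (0∉ ∷ _) = s≤s (length-tailIndices-∉ (All¬⇒¬Any 0∉))
  length-tailIndices {suc _ ∷ is} (_ ∷ us) = s≤s (length-tailIndices us)

module _ {n : ℕ} where

  endpoints-at≥1 : ∀ {a b x : Fin n} → a ≡ x ⊎ b ≡ x
                 → 1 ≤ (if does (a ≟ x) then 1 else 0) + (if does (b ≟ x) then 1 else 0)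
  endpoints-at≥1 {a} {b} {x} (inj₁ a≡x) rewrite dec-true (a ≟ x) a≡x = s≤s z≤n
  endpoints-at≥1 {a} {b} {x} (inj₂ b≡x) rewrite dec-true (b ≟ x) b≡x = m≤n+m 1 _

  Unique-incident-length≤degree : ∀ (G : Graph n) x {es} → Unique es → All (IncidentTo G x) es
                                → length es ≤ degree G x
  Unique-incident-length≤degree (mkGraph []) x {[]} _ _ = z≤n
  Unique-incident-length≤degree (mkGraph ((a , b) ∷ L)) x {es} us incs = split (any? (zero ≟_) es)
    where
    tail-bound : length (tailIndices es) ≤ degree (mkGraph L) x
    tail-bound = Unique-incident-length≤degree (mkGraph L) x (tailIndices-Unique us) (tailIndices-All incs)

    split : Dec (zero ∈ es) → length es ≤ degree (mkGraph ((a , b) ∷ L)) x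
    split (yes 0∈) = ≤-trans (length-tailIndices us) (+-mono-≤ (endpoints-at≥1 (All.lookup incs 0∈)) tail-bound)
    split (no 0∉)  = ≤-trans (length-tailIndices-∉ 0∉) (≤-trans tail-bound (m≤n+m _ _))

module EdgeOrigin {n : ℕ} (u : Fin (suc n)) (new : Fin n × Fin n) where

  smoothedEdges : List (Fin (suc n) × Fin (suc n)) → List (Fin n × Fin n)
  smoothedEdges L = smoothEdges u L ++ new ∷ []

  punchIn² : Fin n × Fin n → Fin (suc n) × Fin (suc n)
  punchIn² p = punchIn u (proj₁ p) , punchIn u (proj₂ p)

  punchIn²-injective : ∀ {p q} → punchIn² p ≡ punchIn² q → p ≡ q
  punchIn²-injective eq =
    cong₂ _,_ (punchIn-injective u _ _ (cong proj₁ eq)) (punchIn-injective u _ _ (cong proj₂ eq))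

  -- The edges of smoothedEdges L are those of L avoiding u, in order, then the new edge;
  -- origin f is the edge of L that f comes from, and nothing for the new edge.
  origin : ∀ L → Fin (length (smoothedEdges L)) → Maybe (Fin (length L))
  origin []              zero = nothing
  origin ((a , b) ∷ L) f with u ≟ a | u ≟ b
  origin ((a , b) ∷ L) zero    | no _  | no _  = just zero
  origin ((a , b) ∷ L) (suc f) | no _  | no _  = map suc (origin L f)
  origin ((a , b) ∷ L) f       | yes _ | _     = map suc (origin L f)
  origin ((a , b) ∷ L) f       | no _  | yes _ = map suc (origin L f)

  OriginOf : ∀ L → Fin n × Fin n → Maybe (Fin (length L)) → Set
  OriginOf L q (just e) = lookup L e ≡ punchIn² q
  OriginOf L q nothing  = q ≡ new

  OriginOf-suc : ∀ {p L q} m → OriginOf L q m → OriginOf (p ∷ L) q (map suc m)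
  OriginOf-suc (just e) h = h
  OriginOf-suc nothing  h = h

  origin-correct : ∀ L f → OriginOf L (lookup (smoothedEdges L) f) (origin L f)
  origin-correct []              zero = refl
  origin-correct ((a , b) ∷ L) f with u ≟ a | u ≟ b
  origin-correct ((a , b) ∷ L) zero    | no u≢a | no u≢b =
    sym (cong₂ _,_ (punchIn-punchOut u≢a) (punchIn-punchOut u≢b))
  origin-correct ((a , b) ∷ L) (suc f) | no _  | no _  = OriginOf-suc (origin L f) (origin-correct L f)
  origin-correct ((a , b) ∷ L) f       | yes _ | _     = OriginOf-suc (origin L f) (origin-correct L f)
  origin-correct ((a , b) ∷ L) f       | no _  | yes _ = OriginOf-suc (origin L f) (origin-correct L f)

  origin-just : ∀ L {f e} → origin L f ≡ just e → lookup L e ≡ punchIn² (lookup (smoothedEdges L) f)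
  origin-just L {f} eq = subst (OriginOf L _) eq (origin-correct L f)

  origin-nothing : ∀ L {f} → origin L f ≡ nothing → lookup (smoothedEdges L) f ≡ new
  origin-nothing L {f} eq = subst (OriginOf L _) eq (origin-correct L f)

  just-zero≢map-suc : ∀ {k} (m : Maybe (Fin k)) → (Maybe (Fin (suc k)) ∋ just zero) ≢ map suc m
  just-zero≢map-suc (just _) ()
  just-zero≢map-suc nothing  ()

  origin-injective : ∀ L f g → origin L f ≡ origin L g → f ≡ g
  origin-injective []              zero zero _ = refl
  origin-injective ((a , b) ∷ L) f g eq with u ≟ a | u ≟ b
  origin-injective ((a , b) ∷ L) zero    zero    eq | no _  | no _  = refl
  origin-injective ((a , b) ∷ L) zero    (suc g) eq | no _  | no _  = ⊥-elim (just-zero≢map-suc (origin L g) eq)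
  origin-injective ((a , b) ∷ L) (suc f) zero    eq | no _  | no _  = ⊥-elim (just-zero≢map-suc (origin L f) (sym eq))
  origin-injective ((a , b) ∷ L) (suc f) (suc g) eq | no _  | no _  =
    cong suc (origin-injective L f g (map-injective suc-injective eq))
  origin-injective ((a , b) ∷ L) f       g       eq | yes _ | _     =
    origin-injective L f g (map-injective suc-injective eq)
  origin-injective ((a , b) ∷ L) f       g       eq | no _  | yes _ =
    origin-injective L f g (map-injective suc-injective eq)

  origin-surjective : ∀ L e → proj₁ (lookup L e) ≢ u → proj₂ (lookup L e) ≢ u
                    → ∃[ f ] origin L f ≡ just e
  origin-surjective ((a , b) ∷ L) e a≢u b≢u with u ≟ a | u ≟ b
  origin-surjective ((a , b) ∷ L) zero    _   _   | no _   | no _   = zero , refl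
  origin-surjective ((a , b) ∷ L) (suc e) a≢u b≢u | no _   | no _   =
    let f , eq = origin-surjective L e a≢u b≢u in suc f , map-just eq
  origin-surjective ((a , b) ∷ L) zero    a≢u _   | yes u≡a | _      = ⊥-elim (a≢u (sym u≡a))
  origin-surjective ((a , b) ∷ L) (suc e) a≢u b≢u | yes _   | _      =
    let f , eq = origin-surjective L e a≢u b≢u in f , map-just eq
  origin-surjective ((a , b) ∷ L) zero    _   b≢u | no _    | yes u≡b = ⊥-elim (b≢u (sym u≡b))
  origin-surjective ((a , b) ∷ L) (suc e) a≢u b≢u | no _    | yes _   =
    let f , eq = origin-surjective L e a≢u b≢u in f , map-just eq

  new-edge : ∀ L → ∃[ f ] origin L f ≡ nothing
  new-edge [] = zero , refl
  new-edge ((a , b) ∷ L) with u ≟ a | u ≟ b | new-edge L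
  ... | no _  | no _  | f , eq = suc f , map-nothing eq
  ... | yes _ | _     | f , eq = f , map-nothing eq
  ... | no _  | yes _ | f , eq = f , map-nothing eq

punchIn≡⇒≡punchOut : ∀ {n} {u w : Fin (suc n)} {x} (u≢w : u ≢ w) → punchIn u x ≡ w → x ≡ punchOut u≢w
punchIn≡⇒≡punchOut {u = u} u≢w eq = punchIn-injective u _ _ (trans eq (sym (punchIn-punchOut u≢w)))

punchOut≡⇒≡punchIn : ∀ {n} {u w : Fin (suc n)} {x} (u≢w : u ≢ w) → punchOut u≢w ≡ x → w ≡ punchIn u x
punchOut≡⇒≡punchIn {u = u} u≢w eq = trans (sym (punchIn-punchOut u≢w)) (cong (punchIn u) eq)

module Smoothing {n : ℕ} (G : Graph (suc n)) (u w₁ w₂ : Fin (suc n)) (deg-u : degree G u ≡ 2)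
                 (u~w₁ : Adj G u w₁) (u~w₂ : Adj G u w₂) (w₁≢w₂ : w₁ ≢ w₂)
                 (u≢w₁ : u ≢ w₁) (u≢w₂ : u ≢ w₂) where

  G' : Graph n
  G' = smooth G u w₁ w₂ u≢w₁ u≢w₂

  open EdgeOrigin u (punchOut u≢w₁ , punchOut u≢w₂)

  ι : Fin n → Fin (suc n)
  ι = punchIn u

  ι-injective : ∀ {x y} → ι x ≡ ι y → x ≡ y
  ι-injective = punchIn-injective u _ _

  e₁ e₂ : Edge G
  e₁ = proj₁ u~w₁
  e₂ = proj₁ u~w₂

  e₁-joins : Joins G e₁ u w₁
  e₁-joins = proj₂ u~w₁

  e₂-joins : Joins G e₂ u w₂
  e₂-joins = proj₂ u~w₂

  e₁≢e₂ : e₁ ≢ e₂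
  e₁≢e₂ eq = w₁≢w₂ (Joins-functional G (subst (λ e → Joins G e u w₁) eq e₁-joins) e₂-joins)

  incident-u : ∀ {e} → IncidentTo G u e → e ≡ e₁ ⊎ e ≡ e₂
  incident-u {e} inc with e ≟ e₁ | e ≟ e₂
  ... | yes e≡e₁ | _        = inj₁ e≡e₁
  ... | no _     | yes e≡e₂ = inj₂ e≡e₂
  ... | no e≢e₁  | no e≢e₂  = ⊥-elim (3≰2 (subst (3 ≤_) deg-u three-edges))
    where
    3≰2 : ¬ 3 ≤ 2
    3≰2 (s≤s (s≤s ()))
    three-edges : 3 ≤ degree G u
    three-edges = Unique-incident-length≤degree G u
      ((e≢e₁ ∷ e≢e₂ ∷ []) ∷ (e₁≢e₂ ∷ []) ∷ [] ∷ [])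
      (inc ∷ Joins⇒IncidentTo G e₁-joins ∷ Joins⇒IncidentTo G e₂-joins ∷ [])

  Joins-u : ∀ {e z} → Joins G e u z → (e ≡ e₁ × z ≡ w₁) ⊎ (e ≡ e₂ × z ≡ w₂)
  Joins-u J with incident-u (Joins⇒IncidentTo G J)
  ... | inj₁ refl = inj₁ (refl , Joins-functional G J e₁-joins)
  ... | inj₂ refl = inj₂ (refl , Joins-functional G J e₂-joins)

  Inherited : List (Edge G) → Maybe (Edge G) → Set
  Inherited T (just e) = e ∈ T
  Inherited T nothing  = e₁ ∈ T × e₂ ∈ T

  inherited? : ∀ T m → Dec (Inherited T m)
  inherited? T (just e) = any? (e ≟_) T
  inherited? T nothing  = any? (e₁ ≟_) T ×-dec any? (e₂ ≟_) T

  smoothEdgeSet : List (Edge G) → List (Edge G')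
  smoothEdgeSet T = filter (λ f → inherited? T (origin (edges G) f)) (allFin _)

  module _ {T : List (Edge G)} where

    ∈-smoothEdgeSet⁺ : ∀ {f} → Inherited T (origin (edges G) f) → f ∈ smoothEdgeSet T
    ∈-smoothEdgeSet⁺ {f} = ∈-filter⁺ (λ f → inherited? T (origin (edges G) f)) (∈-allFin f)

    ∈-smoothEdgeSet⁻ : ∀ {f} → f ∈ smoothEdgeSet T → Inherited T (origin (edges G) f)
    ∈-smoothEdgeSet⁻ f∈ = proj₂ (∈-filter⁻ (λ f → inherited? T (origin (edges G) f)) {xs = allFin _} f∈)

    smoothEdgeSet-Unique : Unique (smoothEdgeSet T)
    smoothEdgeSet-Unique = filter⁺ (λ f → inherited? T (origin (edges G) f)) (allFin⁺ _)

  preimage : ∀ {e q} → ends G e ≡ punchIn² q → ∃[ f ] origin (edges G) f ≡ just e × ends G' f ≡ q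
  preimage {e} eq with origin-surjective (edges G) e (avoids-u (cong proj₁ eq)) (avoids-u (cong proj₂ eq))
    where
    avoids-u : ∀ {a j} → a ≡ ι j → a ≢ u
    avoids-u refl = punchInᵢ≢i u _
  ... | f , of = f , of , punchIn²-injective (trans (sym (origin-just (edges G) of)) eq)

  new : Edge G'
  new = proj₁ (new-edge (edges G))

  new-joins : Joins G' new (punchOut u≢w₁) (punchOut u≢w₂)
  new-joins = inj₁ (origin-nothing (edges G) (proj₂ (new-edge (edges G))))

  IncidentTo-punchIn : ∀ {e f x'} → ends G e ≡ punchIn² (ends G' f) → IncidentTo G' x' f → IncidentTo G (ι x') e
  IncidentTo-punchIn eq (inj₁ r) = inj₁ (trans (cong proj₁ eq) (cong ι r))
  IncidentTo-punchIn eq (inj₂ r) = inj₂ (trans (cong proj₂ eq) (cong ι r))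

  new-ends : ∀ {f} → origin (edges G) f ≡ nothing
           → w₁ ≡ ι (proj₁ (ends G' f)) × w₂ ≡ ι (proj₂ (ends G' f))
  new-ends of =
    let q = origin-nothing (edges G) of
    in punchOut≡⇒≡punchIn u≢w₁ (sym (cong proj₁ q)) , punchOut≡⇒≡punchIn u≢w₂ (sym (cong proj₂ q))

  IncidentTo-new : ∀ {f x'} → origin (edges G) f ≡ nothing → IncidentTo G' x' f
                 → IncidentTo G (ι x') e₁ ⊎ IncidentTo G (ι x') e₂
  IncidentTo-new of (inj₁ r) =
    inj₁ (subst (λ z → IncidentTo G z e₁) (trans (proj₁ (new-ends of)) (cong ι r))
                (Joins⇒IncidentTo G (Joins-sym G e₁-joins)))
  IncidentTo-new of (inj₂ r) =
    inj₂ (subst (λ z → IncidentTo G z e₂) (trans (proj₂ (new-ends of)) (cong ι r))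
                (Joins⇒IncidentTo G (Joins-sym G e₂-joins)))

  lower-joins : ∀ {f e x' v'} → origin (edges G) f ≡ just e → Joins G' f x' v' → Joins G e (ι x') (ι v')
  lower-joins of (inj₁ r) = inj₁ (trans (origin-just (edges G) of) (cong punchIn² r))
  lower-joins of (inj₂ r) = inj₂ (trans (origin-just (edges G) of) (cong punchIn² r))

  new-Joins : ∀ {f x' v'} → origin (edges G) f ≡ nothing → Joins G' f x' v'
            → (w₁ ≡ ι x' × w₂ ≡ ι v') ⊎ (w₂ ≡ ι x' × w₁ ≡ ι v')
  new-Joins of (inj₁ r) =
    inj₁ ( trans (proj₁ (new-ends of)) (cong (ι ∘ proj₁) r)
         , trans (proj₂ (new-ends of)) (cong (ι ∘ proj₂) r))
  new-Joins of (inj₂ r) =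
    inj₂ ( trans (proj₂ (new-ends of)) (cong (ι ∘ proj₂) r)
         , trans (proj₁ (new-ends of)) (cong (ι ∘ proj₁) r))

  origin-just-avoids-u : ∀ {f e} → origin (edges G) f ≡ just e → ¬ IncidentTo G u e
  origin-just-avoids-u of (inj₁ r) = punchInᵢ≢i u _ (trans (sym (cong proj₁ (origin-just (edges G) of))) r)
  origin-just-avoids-u of (inj₂ r) = punchInᵢ≢i u _ (trans (sym (cong proj₂ (origin-just (edges G) of))) r)

  Descends : Edge G → Maybe (Edge G) → Set
  Descends e (just d) = e ≡ d
  Descends e nothing  = IncidentTo G u e

  Descends-injective : ∀ {e} f g → Descends e (origin (edges G) f) → Descends e (origin (edges G) g) → f ≡ g
  Descends-injective f g d d' with origin (edges G) f in of | origin (edges G) g in og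
  ... | just _  | just _  = origin-injective (edges G) f g (trans of (trans (cong just (trans (sym d) d')) (sym og)))
  ... | nothing | nothing = origin-injective (edges G) f g (trans of (sym og))
  ... | just _  | nothing = ⊥-elim (origin-just-avoids-u of (subst (IncidentTo G u) d d'))
  ... | nothing | just _  = ⊥-elim (origin-just-avoids-u og (subst (IncidentTo G u) d' d))

  Descends-new : ∀ {f e w} → origin (edges G) f ≡ nothing → Joins G e u w → Descends e (origin (edges G) f)
  Descends-new {e = e} of J = subst (Descends e) (sym of) (Joins⇒IncidentTo G J)

  -- Expansion fs es: es is fs with each traversal of the new edge replaced by the two edges at u.
  data Expansion : List (Edge G') → List (Edge G) → Set where
    []  : Expansion [] []
    one : ∀ {f fs e es} → Descends e (origin (edges G) f) → Expansion fs es → Expansion (f ∷ fs) (e ∷ es)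
    two : ∀ {f fs e e' es} → Descends e (origin (edges G) f) → Descends e' (origin (edges G) f) → e ≢ e'
        → Expansion fs es → Expansion (f ∷ fs) (e ∷ e' ∷ es)

  ∈-Expansion : ∀ {fs es e} → Expansion fs es → e ∈ es → ∃[ f ] f ∈ fs × Descends e (origin (edges G) f)
  ∈-Expansion (one d _)         (here refl)         = _ , here refl , d
  ∈-Expansion (two d _ _ _)     (here refl)         = _ , here refl , d
  ∈-Expansion (two _ d' _ _)    (there (here refl)) = _ , here refl , d'
  ∈-Expansion (one _ X)         (there e∈)          = let f , f∈ , d = ∈-Expansion X e∈ in f , there f∈ , d
  ∈-Expansion (two _ _ _ X)     (there (there e∈))  = let f , f∈ , d = ∈-Expansion X e∈ in f , there f∈ , d

  Expansion-fresh : ∀ {f fs es e} → f ∉ fs → Expansion fs es → Descends e (origin (edges G) f) → All (e ≢_) es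
  Expansion-fresh {f} {fs} f∉ X d = ¬Any⇒All¬ _ λ e∈ →
    let g , g∈ , d' = ∈-Expansion X e∈ in f∉ (subst (_∈ fs) (sym (Descends-injective f g d d')) g∈)

  Expansion-Unique : ∀ {fs es} → Expansion fs es → Unique fs → Unique es
  Expansion-Unique []             []       = []
  Expansion-Unique (one d X)      (f∉ ∷ U) = Expansion-fresh (All¬⇒¬Any f∉) X d ∷ Expansion-Unique X U
  Expansion-Unique (two d d' e≢ X) (f∉ ∷ U) =
    (e≢ ∷ Expansion-fresh (All¬⇒¬Any f∉) X d) ∷ Expansion-fresh (All¬⇒¬Any f∉) X d'
    ∷ Expansion-Unique X U

  module _ {T : List (Edge G)} where

    image-edge : ∀ {e x v x' v'} → e ∈ T → Joins G e x v → x ≡ ι x' → v ≡ ι v'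
               → ∃[ f ] f ∈ smoothEdgeSet T × Joins G' f x' v'
    image-edge e∈ (inj₁ eq) refl refl =
      let f , of , ends≡ = preimage eq in f , ∈-smoothEdgeSet⁺ (subst (Inherited T) (sym of) e∈) , inj₁ ends≡
    image-edge e∈ (inj₂ eq) refl refl =
      let f , of , ends≡ = preimage eq in f , ∈-smoothEdgeSet⁺ (subst (Inherited T) (sym of) e∈) , inj₂ ends≡

    new-∈ : e₁ ∈ T → e₂ ∈ T → new ∈ smoothEdgeSet T
    new-∈ e₁∈ e₂∈ = ∈-smoothEdgeSet⁺ (subst (Inherited T) (sym (proj₂ (new-edge (edges G)))) (e₁∈ , e₂∈))

    ∈V-smoothEdgeSet⁻ : ∀ {x'} → _∈V_ G' x' (smoothEdgeSet T) → _∈V_ G (ι x') T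
    ∈V-smoothEdgeSet⁻ (f , f∈ , inc) with origin (edges G) f in of | ∈-smoothEdgeSet⁻ f∈
    ... | just e  | e∈        = e , e∈ , IncidentTo-punchIn (origin-just (edges G) of) inc
    ... | nothing | e₁∈ , e₂∈ with IncidentTo-new of inc
    ...   | inj₁ inc₁ = e₁ , e₁∈ , inc₁
    ...   | inj₂ inc₂ = e₂ , e₂∈ , inc₂

    mutual
      lift-walk : ∀ {x y ws x' y'} → Walk G T x y ws → x ≡ ι x' → y ≡ ι y'
                → ∃[ ws' ] Walk G' (smoothEdgeSet T) x' y' ws'
      lift-walk [] refl eq with ι-injective eq
      ... | refl = [] , []
      lift-walk (_∷_ {y = v} (e∈ , J) W) x≡ y≡ with u ≟ v
      ... | yes refl = lift-through-u e∈ J W x≡ y≡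
      ... | no u≢v =
        let f , f∈ , J' = image-edge e∈ J x≡ (sym (punchIn-punchOut u≢v))
            ws' , W'    = lift-walk W (sym (punchIn-punchOut u≢v)) y≡
        in f ∷ ws' , (f∈ , J') ∷ W'

      -- A walk entering u leaves it at once: back along the same edge, or across to the other neighbour.
      lift-through-u : ∀ {x e y ws x' y'} → e ∈ T → Joins G e x u → Walk G T u y ws → x ≡ ι x' → y ≡ ι y'
                     → ∃[ ws' ] Walk G' (smoothEdgeSet T) x' y' ws'
      lift-through-u e∈ J [] _ y≡ = ⊥-elim (punchInᵢ≢i u _ (sym y≡))
      lift-through-u e∈ J ((e'∈ , J') ∷ W) x≡ y≡ with Joins-u (Joins-sym G J) | Joins-u J'
      ... | inj₁ (refl , refl) | inj₁ (refl , refl) = lift-walk W x≡ y≡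
      ... | inj₂ (refl , refl) | inj₂ (refl , refl) = lift-walk W x≡ y≡
      ... | inj₁ (refl , refl) | inj₂ (refl , refl) =
        let ws' , W' = lift-walk W (sym (punchIn-punchOut u≢w₂)) y≡
            x'≡      = punchIn≡⇒≡punchOut u≢w₁ (sym x≡)
        in new ∷ ws' , (new-∈ e∈ e'∈ , subst (λ z → Joins G' new z _) (sym x'≡) new-joins) ∷ W'
      ... | inj₂ (refl , refl) | inj₁ (refl , refl) =
        let ws' , W' = lift-walk W (sym (punchIn-punchOut u≢w₁)) y≡
            x'≡      = punchIn≡⇒≡punchOut u≢w₂ (sym x≡)
        in new ∷ ws' , (new-∈ e'∈ e∈ , subst (λ z → Joins G' new z _) (sym x'≡) (Joins-sym G' new-joins)) ∷ W'

    smoothEdgeSet-Connected : Connected G T → Connected G' (smoothEdgeSet T)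
    smoothEdgeSet-Connected C x' y' x∈ y∈ =
      lift-walk (proj₂ (C (ι x') (ι y') (∈V-smoothEdgeSet⁻ x∈) (∈V-smoothEdgeSet⁻ y∈))) refl refl

    ∈V-smoothEdgeSet⁺ : ∀ {x' y'} → Connected G T → _∈V_ G (ι x') T → _∈V_ G (ι y') T → x' ≢ y'
                      → _∈V_ G' x' (smoothEdgeSet T)
    ∈V-smoothEdgeSet⁺ C x∈ y∈ x'≢y' =
      Walk⇒∈V G' (proj₂ (lift-walk (proj₂ (C _ _ x∈ y∈)) refl refl)) x'≢y'

    lower-walk : ∀ {x' y' fs} → Walk G' (smoothEdgeSet T) x' y' fs
               → ∃[ es ] Expansion fs es × Walk G T (ι x') (ι y') es
    lower-walk [] = [] , [] , []
    lower-walk (_∷_ {e = f} (f∈ , J) W) with lower-walk W | origin (edges G) f in of | ∈-smoothEdgeSet⁻ f∈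
    ... | es , X , W' | just e  | e∈ =
      e ∷ es , one (subst (Descends e) (sym of) refl) X , (e∈ , lower-joins of J) ∷ W'
    ... | es , X , W' | nothing | e₁∈ , e₂∈ with new-Joins of J
    ...   | inj₁ (w₁≡ , w₂≡) =
      e₁ ∷ e₂ ∷ es , two (Descends-new of e₁-joins) (Descends-new of e₂-joins) e₁≢e₂ X ,
        (e₁∈ , subst (λ z → Joins G e₁ z u) w₁≡ (Joins-sym G e₁-joins))
      ∷ (e₂∈ , subst (Joins G e₂ u) w₂≡ e₂-joins) ∷ W'
    ...   | inj₂ (w₂≡ , w₁≡) =
      e₂ ∷ e₁ ∷ es , two (Descends-new of e₂-joins) (Descends-new of e₁-joins) (≢-sym e₁≢e₂) X ,
        (e₂∈ , subst (λ z → Joins G e₂ z u) w₂≡ (Joins-sym G e₂-joins))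
      ∷ (e₁∈ , subst (Joins G e₁ u) w₁≡ e₁-joins) ∷ W'

    smoothEdgeSet-Acyclic : Acyclic G T → Acyclic G' (smoothEdgeSet T)
    smoothEdgeSet-Acyclic A x' f fs U W with lower-walk W
    ... | _ , X@(one _ _)     , W' = A (ι x') _ _ (Expansion-Unique X U) W'
    ... | _ , X@(two _ _ _ _) , W' = A (ι x') _ _ (Expansion-Unique X U) W'

    smoothEdgeSet-IsTree : IsTree G T → IsTree G' (smoothEdgeSet T)
    smoothEdgeSet-IsTree (_ , C , A) = smoothEdgeSet-Unique , smoothEdgeSet-Connected C , smoothEdgeSet-Acyclic A

  smoothEdgeSet-edge-disjoint : ∀ {T T'} → (∀ e → e ∈ T → e ∈ T' → ⊥)
                              → ∀ f → f ∈ smoothEdgeSet T → f ∈ smoothEdgeSet T' → ⊥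
  smoothEdgeSet-edge-disjoint {T} {T'} disjoint f f∈ f∈'
    with origin (edges G) f | ∈-smoothEdgeSet⁻ {T} f∈ | ∈-smoothEdgeSet⁻ {T'} f∈'
  ... | just e  | e∈       | e∈'      = disjoint e e∈ e∈'
  ... | nothing | e₁∈ , _ | e₁∈' , _ = disjoint e₁ e₁∈ e₁∈'

  κ₃≥-smooth : ∀ ℓ → κ₃≥ G ℓ → κ₃≥ G' ℓ
  κ₃≥-smooth ℓ κ a b c (a≢b , a≢c , b≢c)
    with κ (ι a) (ι b) (ι c) (a≢b ∘ ι-injective , a≢c ∘ ι-injective , b≢c ∘ ι-injective)
  ... | T , trees , disjoint = (λ i → smoothEdgeSet (T i)) , trees' , disjoint'
    where
    trees' : ∀ i → IsTree G' (smoothEdgeSet (T i)) × _∈V_ G' a (smoothEdgeSet (T i))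
                 × _∈V_ G' b (smoothEdgeSet (T i)) × _∈V_ G' c (smoothEdgeSet (T i))
    trees' i with trees i
    ... | tree@(_ , C , _) , a∈ , b∈ , c∈ =
      smoothEdgeSet-IsTree tree , ∈V-smoothEdgeSet⁺ C a∈ b∈ a≢b ,
      ∈V-smoothEdgeSet⁺ C b∈ a∈ (≢-sym a≢b) , ∈V-smoothEdgeSet⁺ C c∈ a∈ (≢-sym a≢c)
    disjoint' : ∀ i j → i ≢ j → (∀ f → f ∈ smoothEdgeSet (T i) → f ∈ smoothEdgeSet (T j) → ⊥)
              × (∀ x → _∈V_ G' x (smoothEdgeSet (T i)) → _∈V_ G' x (smoothEdgeSet (T j))
                     → x ≡ a ⊎ x ≡ b ⊎ x ≡ c)
    disjoint' i j i≢j =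
      smoothEdgeSet-edge-disjoint (proj₁ (disjoint i j i≢j)) ,
      λ x x∈ᵢ x∈ⱼ → Sum.map ι-injective (Sum.map ι-injective ι-injective)
                      (proj₂ (disjoint i j i≢j) (ι x) (∈V-smoothEdgeSet⁻ x∈ᵢ) (∈V-smoothEdgeSet⁻ x∈ⱼ))

lemma5 : (n : ℕ) (G : Graph (suc n)) → Simple G
    → (u w₁ w₂ : Fin (suc n)) → degree G u ≡ 2
    → Adj G u w₁ → Adj G u w₂ → w₁ ≢ w₂
    → (p₁ : u ≢ w₁) (p₂ : u ≢ w₂)
    → (ℓ : ℕ) → κ₃≥ G ℓ → κ₃≥ (smooth G u w₁ w₂ p₁ p₂) ℓ
lemma5 n G _ u w₁ w₂ deg-u u~w₁ u~w₂ w₁≢w₂ p₁ p₂ =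
  Smoothing.κ₃≥-smooth G u w₁ w₂ deg-u u~w₁ u~w₂ w₁≢w₂ p₁ p₂
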